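{- If $\mathbf{A}$ is a binary relation with $\delta(\mathbf{A})=\delta(\mathbf{A}^\perp)=2$, then $\mathbf{A}$ and $\mathbf{A}^\perp$ are bimorphic, i.e. there are Tukey morphisms $\mathbf{A}\to\mathbf{A}^\perp$ and $\mathbf{A}^\perp\to\mathbf{A}$.
   Context: A binary relation is a triple $\mathbf{A}=(A_-,A_+,A)$ where $A_-,A_+$ are sets and $A\subseteq A_-\times A_+$. A (Tukey) morphism from $\mathbf{A}$ to $\mathbf{B}$ is a pair of functions $\phi_-\colon B_-\to A_-$, $\phi_+\colon A_+\to B_+$ such that for all $b\in B_-$ and $a\in A_+$, $\phi_-(b)\mathrel{A}a$ implies $b\mathrel{B}\phi_+(a)$. A subset $Y\subseteq A_+$ is $\mathbf{A}$-dominating if for every $a\in A_-$ there is $\alpha\in Y$ with $a\mathrel{A}\alpha$; $\delta(\mathbf{A})$ is the minimum cardinality of an $\mathbf{A}$-dominating family ($\infty$ if none exists). The dual is $\mathbf{A}^\perp=(A_+,A_-,R)$ with $x\mathrel{R}y$ iff not $y\mathrel{A}x$. -}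

module Defs where

open import Level using (0ℓ)
open import Data.Nat using (ℕ; _<_)
open import Data.Fin using (Fin)
open import Data.Product using (Σ; ∃; _×_)
open import Relation.Nullary using (¬_)
open import Relation.Binary.PropositionalEquality using (_≡_)
open import Function.Definitions using (Injective)

record BinRel : Set₁ where
  field
    Neg : Set
    Pos : Set
    Rel : Neg → Pos → Set

open BinRel public

dual : BinRel → BinRel
dual 𝐀 = record { Neg = Pos 𝐀 ; Pos = Neg 𝐀 ; Rel = λ x y → ¬ Rel 𝐀 y x }

record TukeyMorphism (𝐀 𝐁 : BinRel) : Set where
  field
    φ₋ : Neg 𝐁 → Neg 𝐀
    φ₊ : Pos 𝐀 → Pos 𝐁
    preserves : ∀ (b : Neg 𝐁) (a : Pos 𝐀) → Rel 𝐀 (φ₋ b) a → Rel 𝐁 b (φ₊ a)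

Dominating : (𝐀 : BinRel) → (Pos 𝐀 → Set) → Set
Dominating 𝐀 Y = ∀ (a : Neg 𝐀) → Σ (Pos 𝐀) λ α → Y α × Rel 𝐀 a α

-- An A-dominating family of cardinality exactly n: the image of an
-- injective map Fin n → A₊.
DominatingFamilyOfSize : BinRel → ℕ → Set
DominatingFamilyOfSize 𝐀 n =
  Σ (Fin n → Pos 𝐀) λ f → Injective _≡_ _≡_ f × Dominating 𝐀 (λ α → ∃ λ i → f i ≡ α)

δ≡ : BinRel → ℕ → Set
δ≡ 𝐀 n = DominatingFamilyOfSize 𝐀 n × (∀ m → m < n → ¬ DominatingFamilyOfSize 𝐀 m)

Bimorphic : BinRel → BinRel → Set
Bimorphic 𝐀 𝐁 = TukeyMorphism 𝐀 𝐁 × TukeyMorphism 𝐁 𝐀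

-- A dominating family {f 0, f 1} of B gives each a ∈ B₋ an index c a with a B f (c a).
-- If a does not B-relate to f (c b), then c b ≠ c a, so c b is the other index and
-- b B f (other (c a)): hence (f ∘ c, f ∘ other ∘ c) is a morphism B^⊥ → B.  Applied
-- to A this gives A^⊥ → A; applied to A^⊥ it gives A^⊥⊥ → A^⊥, and A → A^⊥⊥ is the
-- identity.  The families supply the indices constructively, so neither excluded
-- middle nor minimality of the families is needed.
module Submission where

open import Defs
open import Level using (0ℓ)
open import Axiom.ExcludedMiddle using (ExcludedMiddle)
open import Data.Fin using (Fin; zero; suc; _≟_)
open import Data.Product using (_,_; proj₁; proj₂)
open import Relation.Nullary using (¬_; yes; no; contradiction)
open import Relation.Binary.PropositionalEquality using (_≡_; _≢_; refl; sym; subst)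

infixr 9 _∘ᵀ_

_∘ᵀ_ : ∀ {𝐀 𝐁 𝐂} → TukeyMorphism 𝐁 𝐂 → TukeyMorphism 𝐀 𝐁 → TukeyMorphism 𝐀 𝐂
ψ ∘ᵀ φ = record
  { φ₋ = λ c → φ₋ φ (φ₋ ψ c)
  ; φ₊ = λ a → φ₊ ψ (φ₊ φ a)
  ; preserves = λ c a r → preserves ψ c (φ₊ φ a) (preserves φ (φ₋ ψ c) a r)
  }
  where open TukeyMorphism

toDoubleDual : (𝐀 : BinRel) → TukeyMorphism 𝐀 (dual (dual 𝐀))
toDoubleDual 𝐀 = record
  { φ₋ = λ a → a
  ; φ₊ = λ α → α
  ; preserves = λ a α r ¬r → ¬r r
  }

other : Fin 2 → Fin 2
other zero = suc zero
other (suc zero) = zero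

≢⇒≡other : {i j : Fin 2} → i ≢ j → i ≡ other j
≢⇒≡other {zero}     {zero}     i≢j = contradiction refl i≢j
≢⇒≡other {zero}     {suc zero} _   = refl
≢⇒≡other {suc zero} {zero}     _   = refl
≢⇒≡other {suc zero} {suc zero} i≢j = contradiction refl i≢j

dominatingPair⇒dual⟶ : (𝐁 : BinRel) → DominatingFamilyOfSize 𝐁 2 → TukeyMorphism (dual 𝐁) 𝐁
dominatingPair⇒dual⟶ 𝐁 (f , _ , dom) = record
  { φ₋ = λ b → f (index b)
  ; φ₊ = λ a → f (other (index a))
  ; preserves = preserves
  }
  where
  index : Neg 𝐁 → Fin 2
  index a = proj₁ (proj₁ (proj₂ (dom a)))

  dominatedAtIndex : ∀ a → Rel 𝐁 a (f (index a))
  dominatedAtIndex a with dom a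
  ... | _ , (_ , refl) , r = r

  preserves : ∀ b a → ¬ Rel 𝐁 a (f (index b)) → Rel 𝐁 b (f (other (index a)))
  preserves b a a⋪fb with index b ≟ index a
  ... | yes eq  = contradiction (subst (λ i → Rel 𝐁 a (f i)) (sym eq) (dominatedAtIndex a)) a⋪fb
  ... | no  neq = subst (λ i → Rel 𝐁 b (f i)) (≢⇒≡other neq) (dominatedAtIndex b)

corollary2p6 : ExcludedMiddle 0ℓ → (𝐀 : BinRel) → δ≡ 𝐀 2 → δ≡ (dual 𝐀) 2 → Bimorphic 𝐀 (dual 𝐀)
corollary2p6 _ 𝐀 (domA , _) (domA⊥ , _) =
  dominatingPair⇒dual⟶ (dual 𝐀) domA⊥ ∘ᵀ toDoubleDual 𝐀 , dominatingPair⇒dual⟶ 𝐀 domA
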